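{- Let $\pi=(d_1,\dots,d_n)$ be the degree sequence of a tree with $d_1\ge d_2\ge\cdots\ge d_k\ge 2$ and $d_{k+1}=\cdots=d_n=1$, where $k\ge 3$. If $C(z_1,\dots,z_k)$ is a minimum optimal caterpillar in $\mathcal{C}_\pi$ (i.e. it minimizes $\varphi$ over $\mathcal{C}_\pi$) with $z_1\ge z_k$, then there exists an integer $t$ with $1\le t\le k-1$ such that $$z_1\ge z_2\ge\cdots\ge z_{t-1}>z_t=d_k-2\quad\text{and}\quad z_t\le z_{t+1}\le\cdots\le z_k.$$
   Context: A subtree of a tree is a nonempty connected subgraph; $\varphi(T)$ is the number of nonempty subtrees of $T$. A caterpillar is a tree containing a path such that every vertex not on the path is adjacent to a vertex on the path; $\mathcal{C}_\pi$ is the set of caterpillars with degree sequence $\pi$. For a permutation $(z_1,\dots,z_k)$ of $(d_1-2,\dots,d_k-2)$, $C(z_1,\dots,z_k)$ is the caterpillar obtained from a path $v_0v_1\cdots v_kv_{k+1}$ by attaching $z_j$ new pendant vertices to $v_j$ for $j=1,\dots,k$; every member of $\mathcal{C}_\pi$ is of this form. -}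

module Defs where

open import Data.Nat using (ℕ; zero; suc; _+_; _∸_; _≤_; _<_)
open import Data.Fin using (Fin; toℕ)
open import Data.Fin.Subset using (Subset; _∈_)
open import Data.Fin.Permutation using (Permutation′; _⟨$⟩ʳ_)
open import Data.List using (List; []; _∷_; map; _++_; upTo; tabulate; length)
open import Data.Nat.ListAction using (sum)
open import Data.List.Membership.Propositional using () renaming (_∈_ to _∈ₗ_)
open import Data.List.Relation.Unary.Unique.Propositional using (Unique)
open import Data.Product using (_×_; _,_; ∃)
open import Data.Sum using (_⊎_)
open import Function.Bundles using (_⇔_)
open import Relation.Binary.PropositionalEquality using (_≡_)

-- Graphs on vertex set {0,…,N-1} given by a list of (undirected) edges.
Edge : Set
Edge = ℕ × ℕ

Adj : List Edge → ℕ → ℕ → Set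
Adj E u v = ((u , v) ∈ₗ E) ⊎ ((v , u) ∈ₗ E)

data Walk {N : ℕ} (E : List Edge) (S : Subset N) : Fin N → Fin N → Set where
  here : ∀ {u} → u ∈ S → Walk E S u u
  step : ∀ {u w v} → u ∈ S → Adj E (toℕ u) (toℕ w) → Walk E S w v → Walk E S u v

-- S is the vertex set of a subtree: nonempty and inducing a connected subgraph.
-- (In a tree, subtrees correspond bijectively to such vertex sets.)
IsSubtreeSet : {N : ℕ} → List Edge → Subset N → Set
IsSubtreeSet {N} E S = ∃ (λ (u : Fin N) → u ∈ S) × (∀ u v → u ∈ S → v ∈ S → Walk E S u v)

SubtreeCount : (N : ℕ) → List Edge → ℕ → Set
SubtreeCount N E m =
  ∃ λ (L : List (Subset N)) → Unique L × (∀ S → (S ∈ₗ L) ⇔ IsSubtreeSet E S) × length L ≡ m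

-- The caterpillar C(z₁,…,z_k): spine path v₀ v₁ … v_{k+1} labelled 0,…,k+1,
-- then z_j pendant vertices attached to v_j (j = 1,…,k), labelled consecutively
-- from k+2 onwards.  Here z is given 0-indexed: z i = z_{i+1}.
pendEdges : ℕ → ℕ → List ℕ → List Edge
pendEdges j f []       = []
pendEdges j f (c ∷ cs) = map (λ p → (j , f + p)) (upTo c) ++ pendEdges (suc j) (f + c) cs

zList : {k : ℕ} → (Fin k → ℕ) → List ℕ
zList {k} z = tabulate z

catOrder : (k : ℕ) → (Fin k → ℕ) → ℕ
catOrder k z = k + 2 + sum (zList z)

catEdges : (k : ℕ) → (Fin k → ℕ) → List Edge
catEdges k z = map (λ i → (i , suc i)) (upTo (suc k)) ++ pendEdges 1 (k + 2) (zList z)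

φCat≡ : (k : ℕ) → (Fin k → ℕ) → ℕ → Set
φCat≡ k z m = SubtreeCount (catOrder k z) (catEdges k z) m

IsPermOf : {k : ℕ} → (Fin k → ℕ) → (Fin k → ℕ) → Set
IsPermOf {k} z d = ∃ λ (σ : Permutation′ k) → ∀ i → z i ≡ d (σ ⟨$⟩ʳ i) ∸ 2

MinOptimal : {k : ℕ} → (d z : Fin k → ℕ) → Set
MinOptimal {k} d z = IsPermOf z d ×
  (∀ (z′ : Fin k → ℕ) → IsPermOf z′ d → ∀ m m′ → φCat≡ k z m → φCat≡ k z′ m′ → m ≤ m′)

-- A subtree of C(z) is a single pendant vertex or a nonempty interval v_a … v_b of the spine
-- together with any set of pendants hanging off it.  With spine weights c = (0, z₁, …, z_k, 0) this
-- gives φ(C(z)) = Σ_{a ≤ b} 2^(c_a + ⋯ + c_b) + Σ_j c_j.  Exchanging adjacent entries p = z_i and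
-- q = z_{i+1} lowers φ by (2^q − 2^p)(R_i − L_i), where L_i sums the weights of the intervals ending
-- just before the pair and R_i of those starting just after it; L_i increases and R_i decreases
-- strictly with i.  At a minimum an ascent at i forces R_i ≤ L_i and a descent at j forces L_j ≤ R_j,
-- so no ascent precedes a descent, and a descent at the last pair would force 1 < L ≤ R = 1.  Hence z
-- falls to its first minimum d_k − 2 strictly before the last entry and never falls afterwards.

module Submission where

open import Defs
open import Data.Nat
  using (ℕ; zero; suc; _+_; _*_; _^_; _∸_; _≤_; _<_; _≥_; _>_; z≤n; s≤s; _≟_; _≤?_; _<?_; >-nonZero)
open import Data.Nat.Properties
open import Data.Bool using (Bool; true; false)
open import Data.Fin using (Fin; zero; suc; toℕ; fromℕ<; _↑ˡ_; _↑ʳ_; splitAt)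
open import Data.Fin.Properties
  using ( toℕ-injective; toℕ<n; toℕ-fromℕ<; fromℕ<-toℕ; fromℕ<-cong; toℕ-↑ˡ; toℕ-↑ʳ; ↑ˡ-injective; ↑ʳ-injective
        ; splitAt-↑ˡ; splitAt-↑ʳ)
open import Data.Fin.Properties using () renaming (_≟_ to _≟ᶠ_)
import Data.Fin.Permutation.Components as PC
open import Data.Fin.Permutation using (transpose; _∘ₚ_; _⟨$⟩ʳ_; _⟨$⟩ˡ_; inverseʳ)
open import Data.Fin.Subset using (Subset; _∈_; _∉_; ⁅_⁆; Nonempty) renaming (⊥ to ∅)
open import Data.Fin.Subset.Properties using (∉⊥; x∈⁅x⁆; x∈⁅y⁆⇒x≡y; ⊆-antisym; Empty-unique; nonempty?; drop-there)
open import Data.Vec using ([]; _∷_; _++_; here; there)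
open import Data.Vec.Properties using (lookup-++ˡ; lookup-++ʳ; []=⇒lookup; lookup⇒[]=; ++-injective; ∷-injective)
import Data.Vec as Vec
open import Data.List using (List; []; _∷_; map; length; allFin; upTo; tabulate; cartesianProductWith)
  renaming (_++_ to _++ₗ_)
open import Data.List.Properties using (length-map; length-++; length-tabulate; ++-assoc)
open import Data.Nat.ListAction using (sum)
open import Data.Nat.ListAction.Properties using (sum-++; sum-↭)
open import Data.List.Relation.Binary.Permutation.Propositional using (↭-swap; ↭-refl)
open import Data.List.Relation.Binary.Permutation.Propositional.Properties using (++⁺ˡ)
open import Data.List.Membership.Propositional using () renaming (_∈_ to _∈ₗ_)
open import Data.List.Membership.Propositional.Properties
  using ( ∈-map⁺; ∈-map⁻; ∈-++⁺ˡ; ∈-++⁺ʳ; ∈-++⁻; ∈-cartesianProductWith⁺; ∈-cartesianProductWith⁻; ∈-allFin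
        ; ∈-upTo⁺; ∈-upTo⁻)
open import Data.List.Relation.Unary.Unique.Propositional using (Unique)
import Data.List.Relation.Unary.Unique.Propositional.Properties as Unique
open import Data.List.Relation.Unary.Any using (here; there)
open import Data.List.Relation.Unary.All as All using ([]; _∷_)
open import Data.List.Relation.Unary.AllPairs using ([]; _∷_)
open import Data.Product using (_×_; _,_; proj₁; proj₂; ∃)
open import Data.Sum using (_⊎_; inj₁; inj₂)
open import Data.Empty using (⊥-elim)
open import Data.Nat.Solver using (module +-*-Solver)
open +-*-Solver using (solve; _:+_; _:*_; _:=_; con)
open import Function.Base using (case_of_)
open import Function.Bundles using (_⇔_; mk⇔)
open import Relation.Nullary using (¬_; Dec; yes; no)
open import Relation.Nullary.Decidable using (dec-true; dec-false)
open import Relation.Binary.PropositionalEquality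
  using (_≡_; _≢_; refl; sym; trans; cong; cong₂; subst; subst₂; module ≡-Reasoning)

-- Subtrees of caterpillars

Adj-sym : ∀ {E a b} → Adj E a b → Adj E b a
Adj-sym (inj₁ e) = inj₂ e
Adj-sym (inj₂ e) = inj₁ e

module _ {N : ℕ} {E : List Edge} {T : Subset N} where

  walk-source∈ : ∀ {u v} → Walk E T u v → u ∈ T
  walk-source∈ (here u∈) = u∈
  walk-source∈ (step u∈ _ _) = u∈

  walk-++ : ∀ {u w v} → Walk E T u w → Walk E T w v → Walk E T u v
  walk-++ (here _) r = r
  walk-++ (step u∈ a w) r = step u∈ a (walk-++ w r)

  walk-reverse : ∀ {u v} → Walk E T u v → Walk E T v u
  walk-reverse (here u∈) = here u∈
  walk-reverse (step u∈ a w) = walk-++ (walk-reverse w) (step (walk-source∈ w) (Adj-sym a) (here u∈))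

data SplitView (m k : ℕ) : Fin (m + k) → Set where
  left  : (i : Fin m) → SplitView m k (i ↑ˡ k)
  right : (j : Fin k) → SplitView m k (m ↑ʳ j)

splitView : ∀ m k (i : Fin (m + k)) → SplitView m k i
splitView zero    k i       = right i
splitView (suc m) k zero    = left zero
splitView (suc m) k (suc i) with splitView m k i
... | left x  = left (suc x)
... | right j = right j

↑ˡ≢↑ʳ : ∀ {m k} (i : Fin m) (j : Fin k) → i ↑ˡ k ≢ m ↑ʳ j
↑ˡ≢↑ʳ {m} {k} i j eq = <⇒≢ (≤-trans (toℕ<n i) (m≤m+n m (toℕ j)))
  (trans (sym (toℕ-↑ˡ i k)) (trans (cong toℕ eq) (toℕ-↑ʳ m j)))

module _ {m k : ℕ} (s : Subset m) (p : Subset k) where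

  ∈-++⁺ˡ-subset : ∀ {i} → i ∈ s → (i ↑ˡ k) ∈ (s ++ p)
  ∈-++⁺ˡ-subset {i} h = lookup⇒[]= _ _ (trans (lookup-++ˡ s p i) ([]=⇒lookup h))

  ∈-++⁺ʳ-subset : ∀ {j} → j ∈ p → (m ↑ʳ j) ∈ (s ++ p)
  ∈-++⁺ʳ-subset {j} h = lookup⇒[]= _ _ (trans (lookup-++ʳ s p j) ([]=⇒lookup h))

  ∈-++⁻ˡ-subset : ∀ {i} → (i ↑ˡ k) ∈ (s ++ p) → i ∈ s
  ∈-++⁻ˡ-subset {i} h = lookup⇒[]= _ _ (trans (sym (lookup-++ˡ s p i)) ([]=⇒lookup h))

  ∈-++⁻ʳ-subset : ∀ {j} → (m ↑ʳ j) ∈ (s ++ p) → j ∈ p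
  ∈-++⁻ʳ-subset {j} h = lookup⇒[]= _ _ (trans (sym (lookup-++ʳ s p j)) ([]=⇒lookup h))

allSubsets : (m : ℕ) → List (Subset m)
allSubsets zero    = [] ∷ []
allSubsets (suc m) = cartesianProductWith _∷_ (true ∷ false ∷ []) (allSubsets m)

length-cartesianProductWith : ∀ {A B C : Set} (f : A → B → C) xs ys →
  length (cartesianProductWith f xs ys) ≡ length xs * length ys
length-cartesianProductWith f []       ys = refl
length-cartesianProductWith f (x ∷ xs) ys =
  trans (length-++ (map (f x) ys)) (cong₂ _+_ (length-map (f x) ys) (length-cartesianProductWith f xs ys))

length-allSubsets : ∀ m → length (allSubsets m) ≡ 2 ^ m
length-allSubsets zero    = refl
length-allSubsets (suc m) =
  trans (length-cartesianProductWith _∷_ (true ∷ false ∷ []) (allSubsets m)) (cong (2 *_) (length-allSubsets m))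

∈-allSubsets : ∀ {m} (s : Subset m) → s ∈ₗ allSubsets m
∈-allSubsets []          = here refl
∈-allSubsets (true ∷ s)  = ∈-cartesianProductWith⁺ _∷_ {xs = true ∷ false ∷ []} (here refl) (∈-allSubsets s)
∈-allSubsets (false ∷ s) = ∈-cartesianProductWith⁺ _∷_ {xs = true ∷ false ∷ []} (there (here refl)) (∈-allSubsets s)

allSubsets-unique : ∀ m → Unique (allSubsets m)
allSubsets-unique zero    = [] ∷ []
allSubsets-unique (suc m) = Unique.cartesianProductWith⁺ {xs = true ∷ false ∷ []} _∷_ ∷-injective
  (((λ ()) ∷ []) ∷ [] ∷ []) (allSubsets-unique m)

-- Pendants are numbered consecutively, spine vertex by spine vertex, as in pendEdges.
attachment : (cs : List ℕ) → Fin (sum cs) → Fin (length cs)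
attachment (c ∷ cs) q with splitAt c q
... | inj₁ _  = zero
... | inj₂ q′ = suc (attachment cs q′)

attachment-↑ˡ : ∀ c cs (i : Fin c) → attachment (c ∷ cs) (i ↑ˡ sum cs) ≡ zero
attachment-↑ˡ c cs i rewrite splitAt-↑ˡ c i (sum cs) = refl

attachment-↑ʳ : ∀ c cs (q : Fin (sum cs)) → attachment (c ∷ cs) (c ↑ʳ q) ≡ suc (attachment cs q)
attachment-↑ʳ c cs q rewrite splitAt-↑ʳ c (sum cs) q = refl

DownClosed : ∀ {n} → Subset n → Set
DownClosed {n} s = ∀ (j l : Fin n) → toℕ j ≤ toℕ l → l ∈ s → j ∈ s

Convex : ∀ {n} → Subset n → Set
Convex {n} s = ∀ (i j l : Fin n) → toℕ i ≤ toℕ j → toℕ j ≤ toℕ l → i ∈ s → l ∈ s → j ∈ s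

Attached : (cs : List ℕ) → Subset (length cs) → Subset (sum cs) → Set
Attached cs s p = ∀ q → q ∈ p → attachment cs q ∈ s

SubsetPair : List ℕ → Set
SubsetPair cs = Subset (length cs) × Subset (sum cs)

IsPrefixPair : (cs : List ℕ) → SubsetPair cs → Set
IsPrefixPair cs (s , p) = DownClosed s × Attached cs s p × Nonempty s

IsIntervalPair : (cs : List ℕ) → SubsetPair cs → Set
IsIntervalPair cs (s , p) = Convex s × Attached cs s p × Nonempty s

module _ {n : ℕ} where

  DownClosed-tail : ∀ {b} {s : Subset n} → DownClosed (b ∷ s) → DownClosed s
  DownClosed-tail dc j l le l∈ = drop-there (dc (suc j) (suc l) (s≤s le) (there l∈))

  DownClosed-true∷ : {s : Subset n} → DownClosed s → DownClosed (true ∷ s)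
  DownClosed-true∷ dc zero    l       le      l∈ = here
  DownClosed-true∷ dc (suc j) (suc l) (s≤s le) l∈ = there (dc j l le (drop-there l∈))

  DownClosed-∅ : DownClosed (∅ {n})
  DownClosed-∅ j l le l∈ = ⊥-elim (∉⊥ l∈)

  DownClosed⇒Convex : {s : Subset n} → DownClosed s → Convex s
  DownClosed⇒Convex dc i j l _ le _ l∈ = dc j l le l∈

  Convex-tail : ∀ {b} {s : Subset n} → Convex (b ∷ s) → Convex s
  Convex-tail cv i j l a b i∈ l∈ = drop-there (cv (suc i) (suc j) (suc l) (s≤s a) (s≤s b) (there i∈) (there l∈))

  Convex-false∷ : {s : Subset n} → Convex s → Convex (false ∷ s)
  Convex-false∷ cv zero    _       _       _       _       () _
  Convex-false∷ cv (suc i) zero    _       ()      _       _  _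
  Convex-false∷ cv (suc i) (suc j) zero    _       ()      _  _
  Convex-false∷ cv (suc i) (suc j) (suc l) (s≤s a) (s≤s b) i∈ l∈ = there (cv i j l a b (drop-there i∈) (drop-there l∈))

  Convex-true∷⇒DownClosed : {s : Subset n} → Convex (true ∷ s) → DownClosed (true ∷ s)
  Convex-true∷⇒DownClosed cv j l le l∈ = cv zero j l z≤n le here l∈

DownClosed⇒zero∈ : ∀ {n} {s : Subset (suc n)} → DownClosed s → Nonempty s → zero ∈ s
DownClosed⇒zero∈ dc (l , l∈) = dc zero l z≤n l∈

zero∈⇒head≡true : ∀ {n b} {s : Subset n} → zero ∈ (b ∷ s) → b ≡ true
zero∈⇒head≡true here = refl

Nonempty-tail : ∀ {n} {s : Subset n} → Nonempty (false ∷ s) → Nonempty s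
Nonempty-tail (suc i , there i∈) = i , i∈

module _ (c : ℕ) (cs : List ℕ) {b : Bool} {s : Subset (length cs)} (B : Subset c) (p : Subset (sum cs)) where

  Attached-tail : Attached (c ∷ cs) (b ∷ s) (B ++ p) → Attached cs s p
  Attached-tail at q q∈ =
    drop-there (subst (_∈ _) (attachment-↑ʳ c cs q) (at (c ↑ʳ q) (∈-++⁺ʳ-subset B p q∈)))

  Attached-head : Attached (c ∷ cs) (b ∷ s) (B ++ p) → ∀ {i} → i ∈ B → b ≡ true
  Attached-head at {i} i∈ =
    zero∈⇒head≡true (subst (_∈ _) (attachment-↑ˡ c cs i) (at (i ↑ˡ sum cs) (∈-++⁺ˡ-subset B p i∈)))

  Attached-∷ : (∀ {i} → i ∈ B → b ≡ true) → Attached cs s p → Attached (c ∷ cs) (b ∷ s) (B ++ p)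
  Attached-∷ head tail q q∈ with splitView c (sum cs) q
  ... | left i  = subst (_∈ _) (sym (attachment-↑ˡ c cs i))
                    (subst (λ x → zero ∈ (x ∷ s)) (sym (head (∈-++⁻ˡ-subset B p q∈))) here)
  ... | right j = subst (_∈ _) (sym (attachment-↑ʳ c cs j)) (there (tail j (∈-++⁻ʳ-subset B p q∈)))

Attached-∅ : ∀ cs (s : Subset (length cs)) → Attached cs s ∅
Attached-∅ cs s q q∈ = ⊥-elim (∉⊥ q∈)

Attached-to-∅ : ∀ cs (p : Subset (sum cs)) → Attached cs ∅ p → p ≡ ∅
Attached-to-∅ cs p at = Empty-unique (λ (q , q∈) → ∉⊥ (at q q∈))

consPrefix : ∀ c cs → Subset c → SubsetPair cs → SubsetPair (c ∷ cs)
consPrefix c cs B (s , p) = (true ∷ s , B ++ p)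

consPrefix-injective : ∀ c cs {B B′ : Subset c} {x y : SubsetPair cs} →
  consPrefix c cs B x ≡ consPrefix c cs B′ y → B ≡ B′ × x ≡ y
consPrefix-injective c cs {B} {B′} {s , p} {s′ , p′} eq
  with ++-injective B B′ (cong proj₂ eq) | ∷-injective (cong proj₁ eq)
... | refl , refl | _ , refl = refl , refl

shiftPair : ∀ c cs → SubsetPair cs → SubsetPair (c ∷ cs)
shiftPair c cs (s , p) = (false ∷ s , ∅ ++ p)

shiftPair-injective : ∀ c cs {x y : SubsetPair cs} → shiftPair c cs x ≡ shiftPair c cs y → x ≡ y
shiftPair-injective c cs {s , p} {s′ , p′} eq
  with ++-injective (∅ {c}) ∅ (cong proj₂ eq) | ∷-injective (cong proj₁ eq)
... | _ , refl | _ , refl = refl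

prefixPairs : (cs : List ℕ) → List (SubsetPair cs)
prefixPairs []       = []
prefixPairs (c ∷ cs) = cartesianProductWith (consPrefix c cs) (allSubsets c) ((∅ , ∅) ∷ prefixPairs cs)

intervalPairs : (cs : List ℕ) → List (SubsetPair cs)
intervalPairs []       = []
intervalPairs (c ∷ cs) = prefixPairs (c ∷ cs) ++ₗ map (shiftPair c cs) (intervalPairs cs)

∈-prefixPairs⁻ : ∀ cs {x} → x ∈ₗ prefixPairs cs → IsPrefixPair cs x
∈-prefixPairs⁻ (c ∷ cs) x∈
  with ∈-cartesianProductWith⁻ (consPrefix c cs) (allSubsets c) ((∅ , ∅) ∷ prefixPairs cs) x∈
... | B , _ , _ , here refl , refl =
  DownClosed-true∷ DownClosed-∅ , Attached-∷ c cs B ∅ (λ _ → refl) (Attached-∅ cs ∅) , (zero , here)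
... | B , (s , p) , _ , there y∈ , refl with ∈-prefixPairs⁻ cs y∈
... | dc , at , _ = DownClosed-true∷ dc , Attached-∷ c cs B p (λ _ → refl) at , (zero , here)

∈-prefixPairs⁺ : ∀ cs (s : Subset (length cs)) (p : Subset (sum cs)) →
                 IsPrefixPair cs (s , p) → (s , p) ∈ₗ prefixPairs cs
∈-prefixPairs⁺ (c ∷ cs) (b ∷ s) p (dc , at , ne) with Vec.splitAt c p
... | B , p′ , refl with zero∈⇒head≡true (DownClosed⇒zero∈ dc ne)
... | refl = ∈-cartesianProductWith⁺ (consPrefix c cs) {xs = allSubsets c} (∈-allSubsets B) rest
  where
  at′ : Attached cs s p′
  at′ = Attached-tail c cs B p′ at
  rest : (s , p′) ∈ₗ (∅ , ∅) ∷ prefixPairs cs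
  rest with nonempty? s
  ... | yes ne′ = there (∈-prefixPairs⁺ cs s p′ (DownClosed-tail dc , at′ , ne′))
  ... | no ¬ne with Empty-unique ¬ne
  ... | refl rewrite Attached-to-∅ cs p′ at′ = here refl

∈-intervalPairs⁻ : ∀ cs {x} → x ∈ₗ intervalPairs cs → IsIntervalPair cs x
∈-intervalPairs⁻ (c ∷ cs) x∈ with ∈-++⁻ (prefixPairs (c ∷ cs)) x∈
... | inj₁ y∈ with ∈-prefixPairs⁻ (c ∷ cs) y∈
... | dc , at , ne = DownClosed⇒Convex dc , at , ne
∈-intervalPairs⁻ (c ∷ cs) x∈ | inj₂ y∈ with ∈-map⁻ (shiftPair c cs) y∈
... | (s , p) , z∈ , refl with ∈-intervalPairs⁻ cs z∈
... | cv , at , (i , i∈) = Convex-false∷ cv , Attached-∷ c cs ∅ p (λ i∈ → ⊥-elim (∉⊥ i∈)) at , (suc i , there i∈)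

∈-intervalPairs⁺ : ∀ cs (s : Subset (length cs)) (p : Subset (sum cs)) →
                   IsIntervalPair cs (s , p) → (s , p) ∈ₗ intervalPairs cs
∈-intervalPairs⁺ (c ∷ cs) (true ∷ s) p (cv , at , ne) =
  ∈-++⁺ˡ (∈-prefixPairs⁺ (c ∷ cs) (true ∷ s) p (Convex-true∷⇒DownClosed cv , at , ne))
∈-intervalPairs⁺ (c ∷ cs) (false ∷ s) p (cv , at , ne) with Vec.splitAt c p
... | B , p′ , refl with Empty-unique {p = B} (λ (i , i∈) → case Attached-head c cs B p′ at i∈ of λ ())
... | refl = ∈-++⁺ʳ (prefixPairs (c ∷ cs)) (∈-map⁺ (shiftPair c cs)
  (∈-intervalPairs⁺ cs s p′ (Convex-tail cv , Attached-tail c cs ∅ p′ at , Nonempty-tail ne)))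

prefixPairs-unique : ∀ cs → Unique (prefixPairs cs)
prefixPairs-unique []       = []
prefixPairs-unique (c ∷ cs) =
  Unique.cartesianProductWith⁺ {xs = allSubsets c} (consPrefix c cs) (consPrefix-injective c cs)
    (allSubsets-unique c) (All.tabulate ∅∉ ∷ prefixPairs-unique cs)
  where
  ∅∉ : ∀ {x} → x ∈ₗ prefixPairs cs → (∅ , ∅) ≢ x
  ∅∉ x∈ refl with ∈-prefixPairs⁻ cs x∈
  ... | _ , _ , (i , i∈) = ∉⊥ i∈

intervalPairs-unique : ∀ cs → Unique (intervalPairs cs)
intervalPairs-unique []       = []
intervalPairs-unique (c ∷ cs) =
  Unique.++⁺ (prefixPairs-unique (c ∷ cs)) (Unique.map⁺ (shiftPair-injective c cs) (intervalPairs-unique cs)) disjoint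
  where
  disjoint : ∀ {x} → ¬ (x ∈ₗ prefixPairs (c ∷ cs) × x ∈ₗ map (shiftPair c cs) (intervalPairs cs))
  disjoint (x∈ , y∈) with ∈-map⁻ (shiftPair c cs) y∈
  ... | _ , _ , refl with ∈-prefixPairs⁻ (c ∷ cs) x∈
  ... | dc , _ , ne with DownClosed⇒zero∈ dc ne
  ... | ()

-- Σ over nonempty prefixes (c₀,…,c_b) of 2^(c₀+⋯+c_b), and Σ over all nonempty intervals.
prefixWeight : List ℕ → ℕ
prefixWeight []       = 0
prefixWeight (c ∷ cs) = 2 ^ c * suc (prefixWeight cs)

intervalWeight : List ℕ → ℕ
intervalWeight []       = 0
intervalWeight (c ∷ cs) = prefixWeight (c ∷ cs) + intervalWeight cs

length-prefixPairs : ∀ cs → length (prefixPairs cs) ≡ prefixWeight cs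
length-prefixPairs []       = refl
length-prefixPairs (c ∷ cs) =
  trans (length-cartesianProductWith (consPrefix c cs) (allSubsets c) ((∅ , ∅) ∷ prefixPairs cs))
        (cong₂ _*_ (length-allSubsets c) (cong suc (length-prefixPairs cs)))

length-intervalPairs : ∀ cs → length (intervalPairs cs) ≡ intervalWeight cs
length-intervalPairs []       = refl
length-intervalPairs (c ∷ cs) = trans (length-++ (prefixPairs (c ∷ cs)))
  (cong₂ _+_ (length-prefixPairs (c ∷ cs))
             (trans (length-map (shiftPair c cs) (intervalPairs cs)) (length-intervalPairs cs)))

Adjacent : ∀ {N} → List Edge → Fin N → Fin N → Set
Adjacent E u v = Adj E (toℕ u) (toℕ v)

spineVertex : ∀ cs → Fin (length cs) → Fin (length cs + sum cs)
spineVertex cs i = i ↑ˡ sum cs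

pendantVertex : ∀ cs → Fin (sum cs) → Fin (length cs + sum cs)
pendantVertex cs q = length cs ↑ʳ q

record IsCaterpillar (cs : List ℕ) (E : List Edge) : Set where
  field
    spine-edge      : ∀ i j → toℕ j ≡ suc (toℕ i) → Adjacent E (spineVertex cs i) (spineVertex cs j)
    pendant-edge    : ∀ q → Adjacent E (spineVertex cs (attachment cs q)) (pendantVertex cs q)
    spine-spine     : ∀ i j → Adjacent E (spineVertex cs i) (spineVertex cs j) →
                      toℕ j ≡ suc (toℕ i) ⊎ toℕ i ≡ suc (toℕ j)
    spine-pendant   : ∀ i q → Adjacent E (spineVertex cs i) (pendantVertex cs q) → attachment cs q ≡ i
    pendant-pendant : ∀ q q′ → ¬ Adjacent E (pendantVertex cs q) (pendantVertex cs q′)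

module _ {cs : List ℕ} {E : List Edge} (cat : IsCaterpillar cs E) where

  open IsCaterpillar cat

  private
    n S : ℕ
    n = length cs
    S = sum cs
    spine : Fin n → Fin (n + S)
    spine = spineVertex cs
    pendant : Fin S → Fin (n + S)
    pendant = pendantVertex cs

  walk-visits-spine-between : ∀ {T u v} → Walk E T u v → ∀ i l j → u ≡ spine i → v ≡ spine l →
                              toℕ i ≤ toℕ j → toℕ j ≤ toℕ l → spine j ∈ T
  walk-visits-spine-between (here u∈) i l j refl v≡ i≤j j≤l with ↑ˡ-injective S i l v≡
  ... | refl = subst (λ x → spine x ∈ _) (toℕ-injective (≤-antisym i≤j j≤l)) u∈
  walk-visits-spine-between (step {w = w} u∈ a rest) i l j refl v≡ i≤j j≤l with toℕ i ≟ toℕ j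
  ... | yes i≡j = subst (λ x → spine x ∈ _) (toℕ-injective i≡j) u∈
  ... | no i≢j with splitView n S w
  ...   | left i′ with spine-spine i i′ a
  ...     | inj₁ up   = walk-visits-spine-between rest i′ l j refl v≡ (subst (_≤ toℕ j) (sym up) (≤∧≢⇒< i≤j i≢j)) j≤l
  ...     | inj₂ down = walk-visits-spine-between rest i′ l j refl v≡
                          (≤-trans (≤-trans (n≤1+n _) (≤-reflexive (sym down))) i≤j) j≤l
  walk-visits-spine-between (step _ _ (here _)) i l j refl v≡ _ _ | no _ | right q = ⊥-elim (↑ˡ≢↑ʳ l q (sym v≡))
  walk-visits-spine-between (step _ a (step {w = w₂} _ a′ rest)) i l j refl v≡ i≤j j≤l | no _ | right q
    with splitView n S w₂
  ... | left i₂  = walk-visits-spine-between rest i₂ l j refl v≡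
                     (subst (λ x → toℕ x ≤ toℕ j) (trans (sym (spine-pendant i q a)) (spine-pendant i₂ q (Adj-sym a′))) i≤j)
                     j≤l
  ... | right q₂ = ⊥-elim (pendant-pendant q q₂ a′)

  walk-visits-attachment : ∀ {T u v} → Walk E T u v → ∀ q l → u ≡ pendant q → v ≡ spine l →
                           spine (attachment cs q) ∈ T
  walk-visits-attachment (here _) q l refl v≡ = ⊥-elim (↑ˡ≢↑ʳ l q (sym v≡))
  walk-visits-attachment (step {w = w} _ a rest) q l refl v≡ with splitView n S w
  ... | left i  = subst (λ x → spine x ∈ _) (sym (spine-pendant i q (Adj-sym a))) (walk-source∈ rest)
  ... | right q₂ = ⊥-elim (pendant-pendant q q₂ a)

  walk-between-pendants : ∀ {T u v} → (∀ i → spine i ∉ T) → Walk E T u v → ∀ q q′ →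
                          u ≡ pendant q → v ≡ pendant q′ → q ≡ q′
  walk-between-pendants _ (here _) q q′ refl v≡ = ↑ʳ-injective n q q′ v≡
  walk-between-pendants noSpine (step {w = w} _ a rest) q q′ refl v≡ with splitView n S w
  ... | left i  = ⊥-elim (noSpine i (walk-source∈ rest))
  ... | right q₂ = ⊥-elim (pendant-pendant q q₂ a)

  IsSubtreeShape : Subset n → Subset S → Set
  IsSubtreeShape s p = IsIntervalPair cs (s , p) ⊎ (s ≡ ∅ × ∃ λ q → p ≡ ⁅ q ⁆)

  subtree⇒shape : ∀ s p → IsSubtreeSet E (s ++ p) → IsSubtreeShape s p
  subtree⇒shape s p ((u , u∈) , conn) with nonempty? s
  ... | yes (i₀ , i₀∈) = inj₁ (convex , attached , (i₀ , i₀∈))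
    where
    convex : Convex s
    convex i j l i≤j j≤l i∈ l∈ = ∈-++⁻ˡ-subset s p (walk-visits-spine-between
      (conn (spine i) (spine l) (∈-++⁺ˡ-subset s p i∈) (∈-++⁺ˡ-subset s p l∈)) i l j refl refl i≤j j≤l)
    attached : Attached cs s p
    attached q q∈ = ∈-++⁻ˡ-subset s p (walk-visits-attachment
      (conn (pendant q) (spine i₀) (∈-++⁺ʳ-subset s p q∈) (∈-++⁺ˡ-subset s p i₀∈)) q i₀ refl refl)
  ... | no ¬ne with splitView n S u
  ...   | left i   = ⊥-elim (¬ne (i , ∈-++⁻ˡ-subset s p u∈))
  ...   | right q₀ = inj₂ (Empty-unique ¬ne , q₀ , ⊆-antisym p⊆ ⊆p)
    where
    noSpine : ∀ i → spine i ∉ (s ++ p)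
    noSpine i i∈ = ¬ne (i , ∈-++⁻ˡ-subset s p i∈)
    p⊆ : ∀ {q} → q ∈ p → q ∈ ⁅ q₀ ⁆
    p⊆ {q} q∈ = subst (_∈ ⁅ q₀ ⁆)
      (walk-between-pendants noSpine (conn (pendant q₀) (pendant q) u∈ (∈-++⁺ʳ-subset s p q∈)) q₀ q refl refl)
      (x∈⁅x⁆ q₀)
    ⊆p : ∀ {q} → q ∈ ⁅ q₀ ⁆ → q ∈ p
    ⊆p q∈ = subst (_∈ p) (sym (x∈⁅y⁆⇒x≡y q₀ q∈)) (∈-++⁻ʳ-subset s p u∈)

  module _ (s : Subset n) (p : Subset S) where

    private
      T : Subset (n + S)
      T = s ++ p

    walk-along-spine : Convex s → ∀ d i l → toℕ l ≡ d + toℕ i → i ∈ s → l ∈ s → Walk E T (spine i) (spine l)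
    walk-along-spine cv zero    i l l≡ i∈ l∈ =
      subst (λ x → Walk E T (spine i) (spine x)) (toℕ-injective (sym l≡)) (here (∈-++⁺ˡ-subset s p i∈))
    walk-along-spine cv (suc d) i l l≡ i∈ l∈ =
      step (∈-++⁺ˡ-subset s p i∈) (spine-edge i i′ i′≡) (walk-along-spine cv d i′ l l≡′ i′∈ l∈)
      where
      i<l : suc (toℕ i) ≤ toℕ l
      i<l = subst (suc (toℕ i) ≤_) (sym l≡) (s≤s (m≤n+m (toℕ i) d))
      i′ : Fin n
      i′ = fromℕ< (≤-<-trans i<l (toℕ<n l))
      i′≡ : toℕ i′ ≡ suc (toℕ i)
      i′≡ = toℕ-fromℕ< _
      l≡′ : toℕ l ≡ d + toℕ i′
      l≡′ = trans l≡ (trans (sym (+-suc d (toℕ i))) (cong (d +_) (sym i′≡)))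
      i′∈ : i′ ∈ s
      i′∈ = cv i i′ l (≤-trans (n≤1+n _) (≤-reflexive (sym i′≡))) (subst (_≤ toℕ l) (sym i′≡) i<l) i∈ l∈

    walk-within-spine : Convex s → ∀ i l → i ∈ s → l ∈ s → Walk E T (spine i) (spine l)
    walk-within-spine cv i l i∈ l∈ with ≤-total (toℕ i) (toℕ l)
    ... | inj₁ i≤l = walk-along-spine cv (toℕ l ∸ toℕ i) i l (sym (m∸n+n≡m i≤l)) i∈ l∈
    ... | inj₂ l≤i = walk-reverse (walk-along-spine cv (toℕ i ∸ toℕ l) l i (sym (m∸n+n≡m l≤i)) l∈ i∈)

    walk-to-spine : Attached cs s p → ∀ u → u ∈ T → ∃ λ i → i ∈ s × Walk E T u (spine i)
    walk-to-spine at u u∈ with splitView n S u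
    ... | left i  = i , ∈-++⁻ˡ-subset s p u∈ , here u∈
    ... | right q = attachment cs q , a∈ , step u∈ (Adj-sym (pendant-edge q)) (here (∈-++⁺ˡ-subset s p a∈))
      where
      a∈ : attachment cs q ∈ s
      a∈ = at q (∈-++⁻ʳ-subset s p u∈)

  shape⇒subtree : ∀ s p → IsSubtreeShape s p → IsSubtreeSet E (s ++ p)
  shape⇒subtree s p (inj₁ (cv , at , (i₀ , i₀∈))) = (spine i₀ , ∈-++⁺ˡ-subset s p i₀∈) , conn
    where
    conn : ∀ u v → u ∈ (s ++ p) → v ∈ (s ++ p) → Walk E (s ++ p) u v
    conn u v u∈ v∈ with walk-to-spine s p at u u∈ | walk-to-spine s p at v v∈
    ... | i , i∈ , wu | l , l∈ , wv = walk-++ wu (walk-++ (walk-within-spine s p cv i l i∈ l∈) (walk-reverse wv))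
  shape⇒subtree s p (inj₂ (refl , q , refl)) = (pendant q , q∈) , conn
    where
    q∈ : pendant q ∈ (∅ ++ ⁅ q ⁆)
    q∈ = ∈-++⁺ʳ-subset ∅ ⁅ q ⁆ (x∈⁅x⁆ q)
    only : ∀ u → u ∈ (∅ ++ ⁅ q ⁆) → u ≡ pendant q
    only u u∈ with splitView n S u
    ... | left i   = ⊥-elim (∉⊥ (∈-++⁻ˡ-subset ∅ ⁅ q ⁆ u∈))
    ... | right q′ = cong (n ↑ʳ_) (x∈⁅y⁆⇒x≡y q (∈-++⁻ʳ-subset ∅ ⁅ q ⁆ u∈))
    conn : ∀ u v → u ∈ (∅ ++ ⁅ q ⁆) → v ∈ (∅ ++ ⁅ q ⁆) → Walk E (∅ ++ ⁅ q ⁆) u v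
    conn u v u∈ v∈ rewrite only u u∈ | only v v∈ = here q∈

  private
    singletonPair : Fin S → SubsetPair cs
    singletonPair q = (∅ , ⁅ q ⁆)

    joinPair : SubsetPair cs → Subset (n + S)
    joinPair (s , p) = s ++ p

    joinPair-injective : ∀ {x y} → joinPair x ≡ joinPair y → x ≡ y
    joinPair-injective {s , p} {s′ , p′} eq with ++-injective s s′ eq
    ... | refl , refl = refl

    singletonPair-injective : ∀ {q q′} → singletonPair q ≡ singletonPair q′ → q ≡ q′
    singletonPair-injective {q} {q′} eq = x∈⁅y⁆⇒x≡y q′ (subst (q ∈_) (cong proj₂ eq) (x∈⁅x⁆ q))

    shapePairs : List (SubsetPair cs)
    shapePairs = intervalPairs cs ++ₗ map singletonPair (allFin S)

    subtreeSets : List (Subset (n + S))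
    subtreeSets = map joinPair shapePairs

    subtreeSets-unique : Unique subtreeSets
    subtreeSets-unique = Unique.map⁺ joinPair-injective
      (Unique.++⁺ (intervalPairs-unique cs) (Unique.map⁺ singletonPair-injective (Unique.allFin⁺ S)) disjoint)
      where
      disjoint : ∀ {x} → ¬ (x ∈ₗ intervalPairs cs × x ∈ₗ map singletonPair (allFin S))
      disjoint (x∈ , y∈) with ∈-map⁻ singletonPair y∈
      ... | q , _ , refl with ∈-intervalPairs⁻ cs x∈
      ... | _ , _ , (i , i∈) = ∉⊥ i∈

    ∈-subtreeSets : ∀ T → (T ∈ₗ subtreeSets) ⇔ IsSubtreeSet E T
    ∈-subtreeSets T = mk⇔ to from
      where
      to : T ∈ₗ subtreeSets → IsSubtreeSet E T
      to T∈ with ∈-map⁻ joinPair T∈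
      ... | (s , p) , x∈ , refl with ∈-++⁻ (intervalPairs cs) x∈
      ...   | inj₁ y∈ = shape⇒subtree s p (inj₁ (∈-intervalPairs⁻ cs y∈))
      ...   | inj₂ y∈ with ∈-map⁻ singletonPair y∈
      ...     | q , _ , refl = shape⇒subtree ∅ ⁅ q ⁆ (inj₂ (refl , q , refl))
      from : IsSubtreeSet E T → T ∈ₗ subtreeSets
      from st with Vec.splitAt n T
      ... | s , p , refl with subtree⇒shape s p st
      ...   | inj₁ ip = ∈-map⁺ joinPair (∈-++⁺ˡ (∈-intervalPairs⁺ cs s p ip))
      ...   | inj₂ (refl , q , refl) = ∈-map⁺ joinPair (∈-++⁺ʳ (intervalPairs cs) (∈-map⁺ singletonPair (∈-allFin q)))

    length-subtreeSets : length subtreeSets ≡ intervalWeight cs + sum cs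
    length-subtreeSets = begin
      length (map joinPair shapePairs)                                    ≡⟨ length-map joinPair shapePairs ⟩
      length shapePairs                                                   ≡⟨ length-++ (intervalPairs cs) ⟩
      length (intervalPairs cs) + length (map singletonPair (allFin S))  ≡⟨ cong₂ _+_ (length-intervalPairs cs)
                                                                             (length-map singletonPair (allFin S)) ⟩
      intervalWeight cs + length (allFin S)                               ≡⟨ cong (intervalWeight cs +_) (length-tabulate (λ q → q)) ⟩
      intervalWeight cs + sum cs                                          ∎
      where open ≡-Reasoning

  caterpillar-subtreeCount : SubtreeCount (n + S) E (intervalWeight cs + sum cs)
  caterpillar-subtreeCount = subtreeSets , subtreeSets-unique , ∈-subtreeSets , length-subtreeSets

∈-pendEdges⁻ : ∀ cs j f {a b} → (a , b) ∈ₗ pendEdges j f cs →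
               ∃ λ q → a ≡ j + toℕ (attachment cs q) × b ≡ f + toℕ q
∈-pendEdges⁻ (c ∷ cs) j f e∈ with ∈-++⁻ (map (λ p → (j , f + p)) (upTo c)) e∈
... | inj₁ e∈′ with ∈-map⁻ (λ p → (j , f + p)) e∈′
...   | p , p∈ , refl = i ↑ˡ sum cs ,
        trans (sym (+-identityʳ j)) (cong (λ x → j + toℕ x) (sym (attachment-↑ˡ c cs i))) ,
        cong (f +_) (trans (sym (toℕ-fromℕ< (∈-upTo⁻ p∈))) (sym (toℕ-↑ˡ i (sum cs))))
  where i = fromℕ< (∈-upTo⁻ p∈)
∈-pendEdges⁻ (c ∷ cs) j f e∈ | inj₂ e∈′ with ∈-pendEdges⁻ cs (suc j) (f + c) e∈′
... | q , refl , refl = c ↑ʳ q ,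
      trans (sym (+-suc j (toℕ (attachment cs q)))) (cong (λ x → j + toℕ x) (sym (attachment-↑ʳ c cs q))) ,
      trans (+-assoc f c (toℕ q)) (cong (f +_) (sym (toℕ-↑ʳ c q)))

∈-pendEdges⁺ : ∀ cs j f (q : Fin (sum cs)) → (j + toℕ (attachment cs q) , f + toℕ q) ∈ₗ pendEdges j f cs
∈-pendEdges⁺ (c ∷ cs) j f q with splitView c (sum cs) q
... | left i  = subst (_∈ₗ pendEdges j f (c ∷ cs))
      (cong₂ _,_ (trans (sym (+-identityʳ j)) (cong (λ x → j + toℕ x) (sym (attachment-↑ˡ c cs i))))
                 (cong (f +_) (sym (toℕ-↑ˡ i (sum cs)))))
      (∈-++⁺ˡ (∈-map⁺ (λ p → (j , f + p)) (∈-upTo⁺ (toℕ<n i))))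
... | right q′ = subst (_∈ₗ pendEdges j f (c ∷ cs))
      (cong₂ _,_ (trans (sym (+-suc j (toℕ (attachment cs q′)))) (cong (λ x → j + toℕ x) (sym (attachment-↑ʳ c cs q′))))
                 (trans (+-assoc f c (toℕ q′)) (cong (f +_) (sym (toℕ-↑ʳ c q′)))))
      (∈-++⁺ʳ (map (λ p → (j , f + p)) (upTo c)) (∈-pendEdges⁺ cs (suc j) (f + c) q′))

pendEdges-++-0 : ∀ cs j f → pendEdges j f (cs ++ₗ 0 ∷ []) ≡ pendEdges j f cs
pendEdges-++-0 []       j f = refl
pendEdges-++-0 (c ∷ cs) j f = cong (map (λ p → (j , f + p)) (upTo c) ++ₗ_) (pendEdges-++-0 cs (suc j) (f + c))

-- The spine v₀ v₁ … v_{k+1} of C(z) carries 0, z₁, …, z_k, 0 pendants.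
spineWeights : ∀ {k} → (Fin k → ℕ) → List ℕ
spineWeights z = 0 ∷ (zList z ++ₗ 0 ∷ [])

module _ (k : ℕ) (z : Fin k → ℕ) where

  private
    cs : List ℕ
    cs = spineWeights z
    n : ℕ
    n = length cs
    E : List Edge
    E = catEdges k z

  length-spineWeights : n ≡ k + 2
  length-spineWeights =
    trans (cong suc (trans (length-++ (zList z)) (cong (_+ 1) (length-tabulate z)))) (sym (+-suc k 1))

  sum-spineWeights : sum cs ≡ sum (zList z)
  sum-spineWeights = trans (sum-++ (zList z) (0 ∷ [])) (+-identityʳ (sum (zList z)))

  ∈-catEdges⁻ : ∀ {a b} → (a , b) ∈ₗ E →
                (b ≡ suc a × b < n) ⊎ ∃ λ q → a ≡ toℕ (attachment cs q) × b ≡ n + toℕ q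
  ∈-catEdges⁻ e∈ with ∈-++⁻ (map (λ i → (i , suc i)) (upTo (suc k))) e∈
  ... | inj₁ e∈′ with ∈-map⁻ (λ i → (i , suc i)) e∈′
  ...   | i , i∈ , refl = inj₁ (refl , subst (suc i <_) (sym length-spineWeights)
                                          (subst (_≤ k + 2) (+-comm i 2) (+-monoˡ-≤ 2 (≤-pred (∈-upTo⁻ i∈)))))
  ∈-catEdges⁻ {a} {b} e∈ | inj₂ e∈′
    with ∈-pendEdges⁻ (zList z ++ₗ 0 ∷ []) 1 (k + 2) (subst ((a , b) ∈ₗ_) (sym (pendEdges-++-0 (zList z) 1 (k + 2))) e∈′)
  ... | q , a≡ , b≡ = inj₂ (q , a≡ , trans b≡ (cong (_+ toℕ q) (sym length-spineWeights)))

  spine-∈-catEdges : ∀ a → suc a < n → (a , suc a) ∈ₗ E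
  spine-∈-catEdges a a<n = ∈-++⁺ˡ (∈-map⁺ (λ i → (i , suc i)) (∈-upTo⁺ a<k+1))
    where
    a<k+1 : a < suc k
    a<k+1 = ≤-pred (subst (suc (suc a) ≤_) (trans length-spineWeights (+-comm k 2)) a<n)

  pendant-∈-catEdges : ∀ q → (toℕ (attachment cs q) , n + toℕ q) ∈ₗ E
  pendant-∈-catEdges q = subst (λ x → (toℕ (attachment cs q) , x + toℕ q) ∈ₗ E) (sym length-spineWeights)
    (∈-++⁺ʳ (map (λ i → (i , suc i)) (upTo (suc k)))
      (subst ((toℕ (attachment cs q) , k + 2 + toℕ q) ∈ₗ_) (pendEdges-++-0 (zList z) 1 (k + 2))
        (∈-pendEdges⁺ (zList z ++ₗ 0 ∷ []) 1 (k + 2) q)))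

  catEdges-source< : ∀ {a b} → (a , b) ∈ₗ E → a < n
  catEdges-source< e∈ with ∈-catEdges⁻ e∈
  ... | inj₁ (refl , b<n) = <-trans (n<1+n _) b<n
  ... | inj₂ (q , refl , _) = toℕ<n (attachment cs q)

  catEdges-isCaterpillar : IsCaterpillar cs E
  catEdges-isCaterpillar = record
    { spine-edge      = λ i j j≡ → toAdj (toℕ-spine i) (toℕ-spine j) (inj₁ (subst (λ x → (toℕ i , x) ∈ₗ E) (sym j≡)
                          (spine-∈-catEdges (toℕ i) (subst (_< n) j≡ (toℕ<n j)))))
    ; pendant-edge    = λ q → toAdj (toℕ-spine (attachment cs q)) (toℕ-pendant q) (inj₁ (pendant-∈-catEdges q))
    ; spine-spine     = λ i j a → spine-spine i j (fromAdj (toℕ-spine i) (toℕ-spine j) a)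
    ; spine-pendant   = λ i q a → spine-pendant i q (fromAdj (toℕ-spine i) (toℕ-pendant q) a)
    ; pendant-pendant = λ q q′ a → pendant-pendant q q′ (fromAdj (toℕ-pendant q) (toℕ-pendant q′) a)
    }
    where
    toℕ-spine : ∀ i → toℕ (spineVertex cs i) ≡ toℕ i
    toℕ-spine i = toℕ-↑ˡ i (sum cs)
    toℕ-pendant : ∀ q → toℕ (pendantVertex cs q) ≡ n + toℕ q
    toℕ-pendant q = toℕ-↑ʳ n q
    toAdj : ∀ {a a′ b b′} → a ≡ a′ → b ≡ b′ → Adj E a′ b′ → Adj E a b
    toAdj a≡ b≡ = subst₂ (Adj E) (sym a≡) (sym b≡)
    fromAdj : ∀ {a a′ b b′} → a ≡ a′ → b ≡ b′ → Adj E a b → Adj E a′ b′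
    fromAdj = subst₂ (Adj E)
    n≰n+ : ∀ {x y} → y < n → y ≢ n + x
    n≰n+ {x} y<n refl = <⇒≱ y<n (m≤m+n n x)

    spine-spine : ∀ (i j : Fin n) → Adj E (toℕ i) (toℕ j) → toℕ j ≡ suc (toℕ i) ⊎ toℕ i ≡ suc (toℕ j)
    spine-spine i j (inj₁ e∈) with ∈-catEdges⁻ e∈
    ... | inj₁ (j≡ , _) = inj₁ j≡
    ... | inj₂ (_ , _ , j≡) = ⊥-elim (n≰n+ (toℕ<n j) j≡)
    spine-spine i j (inj₂ e∈) with ∈-catEdges⁻ e∈
    ... | inj₁ (i≡ , _) = inj₂ i≡
    ... | inj₂ (_ , _ , i≡) = ⊥-elim (n≰n+ (toℕ<n i) i≡)

    spine-pendant : ∀ i q → Adj E (toℕ i) (n + toℕ q) → attachment cs q ≡ i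
    spine-pendant i q (inj₁ e∈) with ∈-catEdges⁻ e∈
    ... | inj₁ (_ , q<n) = ⊥-elim (n≰n+ q<n refl)
    ... | inj₂ (q′ , i≡ , q≡) with toℕ-injective (+-cancelˡ-≡ n (toℕ q) (toℕ q′) q≡)
    ...   | refl = toℕ-injective (sym i≡)
    spine-pendant i q (inj₂ e∈) = ⊥-elim (n≰n+ (catEdges-source< e∈) refl)

    pendant-pendant : ∀ q q′ → ¬ Adj E (n + toℕ q) (n + toℕ q′)
    pendant-pendant q q′ (inj₁ e∈) = n≰n+ (catEdges-source< e∈) refl
    pendant-pendant q q′ (inj₂ e∈) = n≰n+ (catEdges-source< e∈) refl

  φCat≡intervalWeight : φCat≡ k z (intervalWeight cs + sum cs)
  φCat≡intervalWeight = subst (λ N → SubtreeCount N E (intervalWeight cs + sum cs))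
    (cong₂ _+_ length-spineWeights sum-spineWeights) (caterpillar-subtreeCount catEdges-isCaterpillar)

-- Exchanging adjacent spine weights

weight : List ℕ → ℕ
weight []       = 1
weight (c ∷ cs) = 2 ^ c * weight cs

-- Σ over nonempty suffixes (c_a,…,c_last) of 2^(c_a+⋯+c_last).
suffixWeight : List ℕ → ℕ
suffixWeight []       = 0
suffixWeight (c ∷ cs) = weight (c ∷ cs) + suffixWeight cs

weight-∷ʳ : ∀ cs c → weight (cs ++ₗ c ∷ []) ≡ weight cs * 2 ^ c
weight-∷ʳ []       c = trans (*-identityʳ (2 ^ c)) (sym (+-identityʳ (2 ^ c)))
weight-∷ʳ (u ∷ cs) c = trans (cong (2 ^ u *_) (weight-∷ʳ cs c)) (sym (*-assoc (2 ^ u) (weight cs) (2 ^ c)))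

suffixWeight-∷ʳ : ∀ cs c → suffixWeight (cs ++ₗ c ∷ []) ≡ 2 ^ c * suc (suffixWeight cs)
suffixWeight-∷ʳ []       c = +-identityʳ (2 ^ c * 1)
suffixWeight-∷ʳ (u ∷ cs) c = begin
  2 ^ u * weight (cs ++ₗ c ∷ []) + suffixWeight (cs ++ₗ c ∷ [])
    ≡⟨ cong₂ (λ a b → 2 ^ u * a + b) (weight-∷ʳ cs c) (suffixWeight-∷ʳ cs c) ⟩
  2 ^ u * (weight cs * 2 ^ c) + 2 ^ c * suc (suffixWeight cs)
    ≡⟨ solve 4 (λ X P C s → X :* (P :* C) :+ C :* (con 1 :+ s) := C :* (con 1 :+ (X :* P :+ s))) refl
         (2 ^ u) (weight cs) (2 ^ c) (suffixWeight cs) ⟩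
  2 ^ c * suc (2 ^ u * weight cs + suffixWeight cs) ∎
  where open ≡-Reasoning

prefixWeight-swap : ∀ U p q W →
  prefixWeight (U ++ₗ p ∷ q ∷ W) + 2 ^ q * weight U ≡ prefixWeight (U ++ₗ q ∷ p ∷ W) + 2 ^ p * weight U
prefixWeight-swap [] p q W =
  solve 3 (λ x y R → x :* (con 1 :+ y :* (con 1 :+ R)) :+ y :* con 1 := y :* (con 1 :+ x :* (con 1 :+ R)) :+ x :* con 1)
    refl (2 ^ p) (2 ^ q) (prefixWeight W)
prefixWeight-swap (c ∷ U) p q W = begin
  C * suc A + y * (C * P)  ≡⟨ solve 4 (λ C A y P → C :* (con 1 :+ A) :+ y :* (C :* P) := C :+ C :* (A :+ y :* P))
                                refl C A y P ⟩
  C + C * (A + y * P)      ≡⟨ cong (λ t → C + C * t) (prefixWeight-swap U p q W) ⟩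
  C + C * (B + x * P)      ≡⟨ solve 4 (λ C B x P → C :+ C :* (B :+ x :* P) := C :* (con 1 :+ B) :+ x :* (C :* P))
                                refl C B x P ⟩
  C * suc B + x * (C * P)  ∎
  where
  open ≡-Reasoning
  C A B x y P : ℕ
  C = 2 ^ c
  A = prefixWeight (U ++ₗ p ∷ q ∷ W)
  B = prefixWeight (U ++ₗ q ∷ p ∷ W)
  x = 2 ^ p
  y = 2 ^ q
  P = weight U

-- The intervals meeting exactly one of the two swapped entries are those ending at the first
-- or starting at the second; with p first they weigh 2^p (1 + suffixWeight U) + 2^q (1 + prefixWeight W).
intervalWeight-swap : ∀ U p q W →
  intervalWeight (U ++ₗ p ∷ q ∷ W) + (2 ^ p * prefixWeight W + 2 ^ q * suffixWeight U) ≡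
  intervalWeight (U ++ₗ q ∷ p ∷ W) + (2 ^ q * prefixWeight W + 2 ^ p * suffixWeight U)
intervalWeight-swap [] p q W =
  solve 4 (λ x y R G → x :* (con 1 :+ y :* (con 1 :+ R)) :+ (y :* (con 1 :+ R) :+ G) :+ (x :* R :+ y :* con 0)
                    := y :* (con 1 :+ x :* (con 1 :+ R)) :+ (x :* (con 1 :+ R) :+ G) :+ (y :* R :+ x :* con 0))
    refl (2 ^ p) (2 ^ q) (prefixWeight W) (intervalWeight W)
intervalWeight-swap (c ∷ U) p q W = begin
  (a₁ + g₁) + (x * R + y * (P + S))     ≡⟨ solve 7 (λ a₁ g₁ x y R P S → (a₁ :+ g₁) :+ (x :* R :+ y :* (P :+ S))
                                               := (a₁ :+ y :* P) :+ (g₁ :+ (x :* R :+ y :* S))) refl a₁ g₁ x y R P S ⟩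
  (a₁ + y * P) + (g₁ + (x * R + y * S)) ≡⟨ cong₂ _+_ (prefixWeight-swap (c ∷ U) p q W) (intervalWeight-swap U p q W) ⟩
  (a₂ + x * P) + (g₂ + (y * R + x * S)) ≡⟨ solve 7 (λ a₂ g₂ x y R P S → (a₂ :+ x :* P) :+ (g₂ :+ (y :* R :+ x :* S))
                                               := (a₂ :+ g₂) :+ (y :* R :+ x :* (P :+ S))) refl a₂ g₂ x y R P S ⟩
  (a₂ + g₂) + (y * R + x * (P + S))     ∎
  where
  open ≡-Reasoning
  a₁ a₂ g₁ g₂ x y R P S : ℕ
  a₁ = prefixWeight ((c ∷ U) ++ₗ p ∷ q ∷ W)
  a₂ = prefixWeight ((c ∷ U) ++ₗ q ∷ p ∷ W)
  g₁ = intervalWeight (U ++ₗ p ∷ q ∷ W)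
  g₂ = intervalWeight (U ++ₗ q ∷ p ∷ W)
  x = 2 ^ p
  y = 2 ^ q
  R = prefixWeight W
  P = weight (c ∷ U)
  S = suffixWeight U

rearrangement : ∀ {a b c d} → a < b → c < d → a * d + b * c < a * c + b * d
rearrangement {a} {b} {c} {d} a<b c<d =
  subst₂ _<_ (cong₂ (λ b d → a * d + b * c) b≡ d≡) (cong₂ (λ b d → a * c + b * d) b≡ d≡)
    (subst (a * (suc c + f) + (suc a + e) * c <_) expand (s≤s (m≤m+n _ (e + f + e * f))))
  where
  e f : ℕ
  e = b ∸ suc a
  f = d ∸ suc c
  b≡ : suc a + e ≡ b
  b≡ = m+[n∸m]≡n a<b
  d≡ : suc c + f ≡ d
  d≡ = m+[n∸m]≡n c<d
  expand : suc (a * (suc c + f) + (suc a + e) * c + (e + f + e * f)) ≡ a * c + (suc a + e) * (suc c + f)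
  expand = solve 4 (λ a c e f → con 1 :+ (a :* (con 1 :+ c :+ f) :+ (con 1 :+ a :+ e) :* c :+ (e :+ f :+ e :* f))
                              := a :* c :+ (con 1 :+ a :+ e) :* (con 1 :+ c :+ f)) refl a c e f

rearrangement-≤ : ∀ {a b c d} → a * c + b * d ≤ a * d + b * c → a < b → d ≤ c
rearrangement-≤ {a} {b} {c} {d} le a<b with d ≤? c
... | yes d≤c = d≤c
... | no d≰c = ⊥-elim (<⇒≱ (rearrangement a<b (≰⇒> d≰c)) le)

segment : (ℕ → ℕ) → ℕ → ℕ → List ℕ
segment f a zero    = []
segment f a (suc n) = f a ∷ segment f (suc a) n

segment-++ : ∀ f a m n → segment f a (m + n) ≡ segment f a m ++ₗ segment f (a + m) n
segment-++ f a zero    n = cong (λ x → segment f x n) (sym (+-identityʳ a))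
segment-++ f a (suc m) n = cong (f a ∷_)
  (trans (segment-++ f (suc a) m n) (cong (λ x → segment f (suc a) m ++ₗ segment f x n) (sym (+-suc a m))))

segment-cong : ∀ f g a n → (∀ j → a ≤ j → j < a + n → f j ≡ g j) → segment f a n ≡ segment g a n
segment-cong f g a zero    _  = refl
segment-cong f g a (suc n) eq = cong₂ _∷_ (eq a ≤-refl (subst (a <_) (sym (+-suc a n)) (s≤s (m≤m+n a n))))
  (segment-cong f g (suc a) n (λ j a<j j< → eq j (≤-trans (n≤1+n a) a<j) (subst (j <_) (sym (+-suc a n)) j<)))

tabulate≡segment : ∀ {k} (z : Fin k → ℕ) f a → (∀ j → z j ≡ f (a + toℕ j)) → tabulate z ≡ segment f a k
tabulate≡segment {zero}  z f a eq = refl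
tabulate≡segment {suc k} z f a eq = cong₂ _∷_ (trans (eq zero) (cong f (+-identityʳ a)))
  (tabulate≡segment (λ j → z (suc j)) f (suc a) (λ j → trans (eq (suc j)) (cong f (+-suc a (toℕ j)))))

extend : ∀ {k} → (Fin k → ℕ) → ℕ → ℕ
extend {k} z x with x <? k
... | yes x<k = z (fromℕ< x<k)
... | no _    = 0

extend-fromℕ< : ∀ {k} (z : Fin k → ℕ) x (x<k : x < k) → extend z x ≡ z (fromℕ< x<k)
extend-fromℕ< {k} z x x<k with x <? k
... | yes x<k′ = cong z (fromℕ<-cong x x refl x<k′ x<k)
... | no x≮k   = ⊥-elim (x≮k x<k)

extend-toℕ : ∀ {k} (z : Fin k → ℕ) j → z j ≡ extend z (toℕ j)
extend-toℕ z j = trans (cong z (sym (fromℕ<-toℕ j (toℕ<n j)))) (sym (extend-fromℕ< z (toℕ j) (toℕ<n j)))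

n<2^c*[1+n] : ∀ c n → n < 2 ^ c * suc n
n<2^c*[1+n] c n = m≤n*m (suc n) (2 ^ c) {{>-nonZero (m^n>0 2 c)}}

-- The L_i and R_i of exchanging f i and f (1 + i), for f a sequence of length k.
module _ (f : ℕ → ℕ) (k : ℕ) where

  leftWeight : ℕ → ℕ
  leftWeight i = suffixWeight (0 ∷ segment f 0 i)

  rightWeight : ℕ → ℕ
  rightWeight i = prefixWeight (segment f (2 + i) (k ∸ (2 + i)) ++ₗ 0 ∷ [])

  leftWeight-suc : ∀ i → leftWeight i < leftWeight (suc i)
  leftWeight-suc i = subst (leftWeight i <_) (sym L[1+i]≡) (n<2^c*[1+n] (f i) (leftWeight i))
    where
    L[1+i]≡ : leftWeight (suc i) ≡ 2 ^ f i * suc (leftWeight i)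
    L[1+i]≡ = trans (cong (λ t → suffixWeight (0 ∷ t)) (trans (cong (segment f 0) (+-comm 1 i)) (segment-++ f 0 i 1)))
                    (suffixWeight-∷ʳ (0 ∷ segment f 0 i) (f i))

  leftWeight-strictMono : ∀ {i j} → i < j → leftWeight i < leftWeight j
  leftWeight-strictMono {i} {suc j} (s≤s i≤j) with m≤n⇒m<n∨m≡n i≤j
  ... | inj₁ i<j  = <-trans (leftWeight-strictMono i<j) (leftWeight-suc j)
  ... | inj₂ refl = leftWeight-suc i

  rightWeight-suc : ∀ i → 3 + i ≤ k → rightWeight (suc i) < rightWeight i
  rightWeight-suc i 3+i≤k = subst (rightWeight (suc i) <_) (sym R[i]≡) (n<2^c*[1+n] (f (2 + i)) (rightWeight (suc i)))
    where
    R[i]≡ : rightWeight i ≡ 2 ^ f (2 + i) * suc (rightWeight (suc i))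
    R[i]≡ = cong (λ t → prefixWeight (segment f (2 + i) t ++ₗ 0 ∷ [])) (+-∸-assoc 1 3+i≤k)

  rightWeight-antitone : ∀ {i j} → i ≤ j → 2 + j ≤ k → rightWeight j ≤ rightWeight i
  rightWeight-antitone {i} {j} i≤j 2+j≤k with m≤n⇒m<n∨m≡n i≤j
  ... | inj₂ refl = ≤-refl
  ... | inj₁ (s≤s i≤j′) =
    ≤-trans (<⇒≤ (rightWeight-suc _ 2+j≤k)) (rightWeight-antitone i≤j′ (≤-trans (n≤1+n _) 2+j≤k))

  rightWeight-last : ∀ i → 2 + i ≡ k → rightWeight i ≡ 1
  rightWeight-last i refl = cong (λ t → prefixWeight (segment f (2 + i) t ++ₗ 0 ∷ [])) (n∸n≡0 (2 + i))

module _ {n : ℕ} (a b : Fin n) where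

  transpose-left : PC.transpose a b a ≡ b
  transpose-left rewrite dec-true (a ≟ᶠ a) refl = refl

  transpose-right : PC.transpose a b b ≡ a
  transpose-right with b ≟ᶠ a
  ... | yes refl = refl
  ... | no _ rewrite dec-true (b ≟ᶠ b) refl = refl

  transpose-other : ∀ j → j ≢ a → j ≢ b → PC.transpose a b j ≡ j
  transpose-other j j≢a j≢b rewrite dec-false (j ≟ᶠ a) j≢a | dec-false (j ≟ᶠ b) j≢b = refl

module _ {k : ℕ} (z : Fin k → ℕ) (i : ℕ) (2+i≤k : 2 + i ≤ k) where

  private
    i<k : i < k
    i<k = ≤-trans (n≤1+n (suc i)) 2+i≤k
    a b : Fin k
    a = fromℕ< i<k
    b = fromℕ< 2+i≤k

  swapAdjacent : Fin k → ℕ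
  swapAdjacent j = z (PC.transpose a b j)

  swapAdjacent-isPermOf : ∀ {d} → IsPermOf z d → IsPermOf swapAdjacent d
  swapAdjacent-isPermOf (σ , zσ) = transpose a b ∘ₚ σ , λ j → zσ (PC.transpose a b j)

  private
    extend-swapAdjacent : ∀ {x} (x<k : x < k) → extend swapAdjacent x ≡ z (PC.transpose a b (fromℕ< x<k))
    extend-swapAdjacent {x} x<k = extend-fromℕ< swapAdjacent x x<k

  extend-swapAdjacent-i : extend swapAdjacent i ≡ extend z (suc i)
  extend-swapAdjacent-i = trans (extend-swapAdjacent i<k) (trans (cong z (transpose-left a b)) (sym (extend-fromℕ< z (suc i) 2+i≤k)))

  extend-swapAdjacent-suc : extend swapAdjacent (suc i) ≡ extend z i
  extend-swapAdjacent-suc = trans (extend-swapAdjacent 2+i≤k) (trans (cong z (transpose-right a b)) (sym (extend-fromℕ< z i i<k)))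

  extend-swapAdjacent-other : ∀ x → x < k → x ≢ i → x ≢ suc i → extend swapAdjacent x ≡ extend z x
  extend-swapAdjacent-other x x<k x≢i x≢1+i =
    trans (extend-swapAdjacent x<k) (trans (cong z (transpose-other a b c (c≢ x≢i i<k) (c≢ x≢1+i 2+i≤k))) (sym (extend-fromℕ< z x x<k)))
    where
    c : Fin k
    c = fromℕ< x<k
    c≢ : ∀ {y} → x ≢ y → (y<k : y < k) → c ≢ fromℕ< y<k
    c≢ {y} x≢y y<k c≡ = x≢y (trans (sym (toℕ-fromℕ< x<k)) (trans (cong toℕ c≡) (toℕ-fromℕ< y<k)))

spineWeights-split : ∀ {k} (z : Fin k → ℕ) i → 2 + i ≤ k →
  spineWeights z ≡ (0 ∷ segment (extend z) 0 i) ++ₗ extend z i ∷ extend z (suc i) ∷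
                   (segment (extend z) (2 + i) (k ∸ (2 + i)) ++ₗ 0 ∷ [])
spineWeights-split {k} z i 2+i≤k =
  trans (cong (λ t → 0 ∷ (t ++ₗ 0 ∷ [])) tabulate≡) (cong (0 ∷_) (++-assoc A (g i ∷ g (suc i) ∷ B) (0 ∷ [])))
  where
  g : ℕ → ℕ
  g = extend z
  r : ℕ
  r = k ∸ (2 + i)
  A B : List ℕ
  A = segment g 0 i
  B = segment g (2 + i) r
  k≡ : i + (2 + r) ≡ k
  k≡ = trans (trans (sym (+-assoc i 2 r)) (cong (_+ r) (+-comm i 2))) (m+[n∸m]≡n 2+i≤k)
  tabulate≡ : tabulate z ≡ A ++ₗ g i ∷ g (suc i) ∷ B
  tabulate≡ = trans (tabulate≡segment z g 0 (extend-toℕ z)) (trans (cong (segment g 0) (sym k≡)) (segment-++ g 0 i (2 + r)))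

spineWeights-swapAdjacent : ∀ {k} (z : Fin k → ℕ) i (2+i≤k : 2 + i ≤ k) →
  spineWeights (swapAdjacent z i 2+i≤k) ≡ (0 ∷ segment (extend z) 0 i) ++ₗ extend z (suc i) ∷ extend z i ∷
                                          (segment (extend z) (2 + i) (k ∸ (2 + i)) ++ₗ 0 ∷ [])
spineWeights-swapAdjacent {k} z i 2+i≤k = trans (spineWeights-split z′ i 2+i≤k)
  (cong₂ (λ A B → (0 ∷ A) ++ₗ B) (segment-cong g′ g 0 i before)
    (cong₂ _∷_ (extend-swapAdjacent-i z i 2+i≤k) (cong₂ _∷_ (extend-swapAdjacent-suc z i 2+i≤k)
      (cong (_++ₗ 0 ∷ []) (segment-cong g′ g (2 + i) (k ∸ (2 + i)) after)))))
  where
  z′ : Fin k → ℕ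
  z′ = swapAdjacent z i 2+i≤k
  g g′ : ℕ → ℕ
  g = extend z
  g′ = extend z′
  before : ∀ j → 0 ≤ j → j < i → g′ j ≡ g j
  before j _ j<i = extend-swapAdjacent-other z i 2+i≤k j (<-trans j<i (≤-trans (n≤1+n _) 2+i≤k))
    (<⇒≢ j<i) (<⇒≢ (<-trans j<i (n<1+n i)))
  after : ∀ j → 2 + i ≤ j → j < 2 + i + (k ∸ (2 + i)) → g′ j ≡ g j
  after j 2+i≤j j< = extend-swapAdjacent-other z i 2+i≤k j (subst (j <_) (m+[n∸m]≡n 2+i≤k) j<)
    (λ { refl → 1+n≰n (≤-trans (n≤1+n (suc i)) 2+i≤j) }) (λ { refl → 1+n≰n 2+i≤j })

module _ {k : ℕ} {d z : Fin k → ℕ} (opt : MinOptimal d z) where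

  private
    f L R : ℕ → ℕ
    f = extend z
    L = leftWeight f k
    R = rightWeight f k

  swap-inequality : ∀ i → 2 + i ≤ k →
    2 ^ f (suc i) * R i + 2 ^ f i * L i ≤ 2 ^ f i * R i + 2 ^ f (suc i) * L i
  swap-inequality i 2+i≤k = +-cancelˡ-≤ (intervalWeight X′) _ _ (begin
    intervalWeight X′ + (y * R i + x * L i) ≡⟨ intervalWeight-swap U p q W ⟨
    intervalWeight X + (x * R i + y * L i)  ≤⟨ +-monoˡ-≤ _ intervalWeight-≤ ⟩
    intervalWeight X′ + (x * R i + y * L i) ∎)
    where
    open ≤-Reasoning
    z′ : Fin k → ℕ
    z′ = swapAdjacent z i 2+i≤k
    p q x y : ℕ
    p = f i
    q = f (suc i)
    x = 2 ^ p
    y = 2 ^ q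
    U W X X′ : List ℕ
    U = 0 ∷ segment f 0 i
    W = segment f (2 + i) (k ∸ (2 + i)) ++ₗ 0 ∷ []
    X = U ++ₗ p ∷ q ∷ W
    X′ = U ++ₗ q ∷ p ∷ W
    φ-≤ : intervalWeight X + sum X ≤ intervalWeight X′ + sum X′
    φ-≤ = subst₂ (λ cs cs′ → intervalWeight cs + sum cs ≤ intervalWeight cs′ + sum cs′)
      (spineWeights-split z i 2+i≤k) (spineWeights-swapAdjacent z i 2+i≤k)
      (proj₂ opt z′ (swapAdjacent-isPermOf z i 2+i≤k {d} (proj₁ opt)) _ _
        (φCat≡intervalWeight k z) (φCat≡intervalWeight k z′))
    intervalWeight-≤ : intervalWeight X ≤ intervalWeight X′
    intervalWeight-≤ = +-cancelʳ-≤ (sum X) _ _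
      (subst (λ s → intervalWeight X + sum X ≤ intervalWeight X′ + s) (sym (sum-↭ (++⁺ˡ U (↭-swap p q ↭-refl))))
        φ-≤)

  descent⇒left≤right : ∀ i → 2 + i ≤ k → f (suc i) < f i → L i ≤ R i
  descent⇒left≤right i 2+i≤k desc = rearrangement-≤ swapped (^-monoʳ-< 2 (s≤s (s≤s z≤n)) desc)
    where
    swapped : 2 ^ f (suc i) * R i + 2 ^ f i * L i ≤ 2 ^ f (suc i) * L i + 2 ^ f i * R i
    swapped = subst (2 ^ f (suc i) * R i + 2 ^ f i * L i ≤_) (+-comm (2 ^ f i * R i) _) (swap-inequality i 2+i≤k)

  ascent⇒right≤left : ∀ i → 2 + i ≤ k → f i < f (suc i) → R i ≤ L i
  ascent⇒right≤left i 2+i≤k asc = rearrangement-≤ swapped (^-monoʳ-< 2 (s≤s (s≤s z≤n)) asc)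
    where
    swapped : 2 ^ f i * L i + 2 ^ f (suc i) * R i ≤ 2 ^ f i * R i + 2 ^ f (suc i) * L i
    swapped = subst (_≤ 2 ^ f i * R i + 2 ^ f (suc i) * L i) (+-comm (2 ^ f (suc i) * R i) _) (swap-inequality i 2+i≤k)

  -- Between an ascent at i and a descent at j > i we would get L j ≤ R j ≤ R i ≤ L i < L j.
  no-ascent-before-descent : ∀ {i j} → i < j → 2 + j ≤ k → f i < f (suc i) → ¬ f (suc j) < f j
  no-ascent-before-descent {i} {j} i<j 2+j≤k asc desc = <⇒≱ (leftWeight-strictMono f k i<j) (begin
    L j ≤⟨ descent⇒left≤right j 2+j≤k desc ⟩
    R j ≤⟨ rightWeight-antitone f k (<⇒≤ i<j) 2+j≤k ⟩
    R i ≤⟨ ascent⇒right≤left i (≤-trans (s≤s (s≤s (<⇒≤ i<j))) 2+j≤k) asc ⟩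
    L i ∎)
    where open ≤-Reasoning

  last-step-not-descent : ∀ i → 0 < i → 2 + i ≡ k → ¬ f (suc i) < f i
  last-step-not-descent i 0<i 2+i≡k desc = <⇒≱ (leftWeight-strictMono f k 0<i) (begin
    L i ≤⟨ descent⇒left≤right i (≤-reflexive 2+i≡k) desc ⟩
    R i ≡⟨ rightWeight-last f k i 2+i≡k ⟩
    1   ∎)
    where open ≤-Reasoning

  first-minimum-not-last : 3 ≤ k → ∀ t → t < k → (∀ j → j < t → f t < f j) → 2 + t ≤ k
  first-minimum-not-last 3≤k t t<k first with m≤n⇒m<n∨m≡n t<k
  ... | inj₁ 1+t<k = 1+t<k
  ... | inj₂ 1+t≡k with t
  ...   | zero        = ⊥-elim (<⇒≱ 3≤k (≤-trans (≤-reflexive (sym 1+t≡k)) (n≤1+n 1)))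
  ...   | suc zero    = ⊥-elim (<⇒≱ 3≤k (≤-reflexive (sym 1+t≡k)))
  ...   | suc (suc i) = ⊥-elim (last-step-not-descent (suc i) (s≤s z≤n) 1+t≡k (first (suc i) ≤-refl))

-- Valley-shaped sequences

module _ (f : ℕ → ℕ) where

  steps-≤⇒≤ : ∀ {i} j → i ≤ j → (∀ {l} → i ≤ l → l < j → f l ≤ f (suc l)) → f i ≤ f j
  steps-≤⇒≤ j i≤j rises with m≤n⇒m<n∨m≡n i≤j
  steps-≤⇒≤ j       i≤j rises | inj₂ refl       = ≤-refl
  steps-≤⇒≤ (suc j) i≤j rises | inj₁ (s≤s i≤j′) =
    ≤-trans (steps-≤⇒≤ j i≤j′ (λ i≤l l<j → rises i≤l (m<n⇒m<1+n l<j))) (rises i≤j′ ≤-refl)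

  steps-≥⇒≥ : ∀ {i} j → i ≤ j → (∀ {l} → i ≤ l → l < j → f (suc l) ≤ f l) → f j ≤ f i
  steps-≥⇒≥ j i≤j falls with m≤n⇒m<n∨m≡n i≤j
  steps-≥⇒≥ j       i≤j falls | inj₂ refl       = ≤-refl
  steps-≥⇒≥ (suc j) i≤j falls | inj₁ (s≤s i≤j′) =
    ≤-trans (falls i≤j′ ≤-refl) (steps-≥⇒≥ j i≤j′ (λ i≤l l<j → falls i≤l (m<n⇒m<1+n l<j)))

module _ (f : ℕ → ℕ) (k : ℕ)
         (no-ascent-before-descent : ∀ {i j} → i < j → 2 + j ≤ k → f i < f (suc i) → ¬ f (suc j) < f j)
         {t : ℕ} (t<k : t < k) (minimum : ∀ x → x < k → f t ≤ f x) where

  nonincreasing-before-minimum : ∀ i → suc i ≤ t → f (suc i) ≤ f i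
  nonincreasing-before-minimum i 1+i≤t with f i <? f (suc i)
  ... | no ¬asc = ≮⇒≥ ¬asc
  ... | yes asc = ⊥-elim (<⇒≱ asc (≤-trans (steps-≤⇒≤ f t 1+i≤t no-descent) (minimum i (<-trans 1+i≤t t<k))))
    where
    no-descent : ∀ {l} → suc i ≤ l → l < t → f l ≤ f (suc l)
    no-descent i<l l<t = ≮⇒≥ (no-ascent-before-descent i<l (≤-trans (s≤s l<t) t<k) asc)

  nondecreasing-from-minimum : ∀ i → t ≤ i → 2 + i ≤ k → f i ≤ f (suc i)
  nondecreasing-from-minimum i t≤i 2+i≤k with f (suc i) <? f i
  ... | no ¬desc = ≮⇒≥ ¬desc
  ... | yes desc = ⊥-elim (<⇒≱ desc (≤-trans (steps-≥⇒≥ f i t≤i no-ascent) (minimum (suc i) 2+i≤k)))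
    where
    no-ascent : ∀ {l} → t ≤ l → l < i → f (suc l) ≤ f l
    no-ascent _ l<i = ≮⇒≥ (λ asc → no-ascent-before-descent l<i 2+i≤k asc desc)

least-below : {P : ℕ → Set} → (∀ x → Dec (P x)) → ∀ n →
  (∃ λ t → t < n × P t × (∀ j → j < t → ¬ P j)) ⊎ (∀ j → j < n → ¬ P j)
least-below P? zero = inj₂ (λ _ ())
least-below P? (suc n) with least-below P? n
... | inj₁ (t , t<n , pt , below) = inj₁ (t , m<n⇒m<1+n t<n , pt , below)
... | inj₂ none with P? n
...   | yes pn = inj₁ (n , ≤-refl , pn , none)
...   | no ¬pn = inj₂ λ j j<1+n → case m≤n⇒m<n∨m≡n (≤-pred j<1+n) of λ
        { (inj₁ j<n) → none j j<n
        ; (inj₂ refl) → ¬pn }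

least-witness : {P : ℕ → Set} → (∀ x → Dec (P x)) → ∀ {n x} → x < n → P x →
  ∃ λ t → t < n × P t × (∀ j → j < t → ¬ P j)
least-witness P? {n} x<n px with least-below P? n
... | inj₁ least = least
... | inj₂ none  = ⊥-elim (none _ x<n px)

IsPermOf-attains : ∀ {k} {z d : Fin k → ℕ} → IsPermOf z d → ∀ l → ∃ λ j → z j ≡ d l ∸ 2
IsPermOf-attains {d = d} (σ , zσ) l = σ ⟨$⟩ˡ l , trans (zσ (σ ⟨$⟩ˡ l)) (cong (λ x → d x ∸ 2) (inverseʳ σ))

IsPermOf-lowerBound : ∀ {k} {z d : Fin k → ℕ} → IsPermOf z d → ∀ {l} → (∀ i → d l ≤ d i) → ∀ j → d l ∸ 2 ≤ z j
IsPermOf-lowerBound (σ , zσ) minimal j = subst (_ ≤_) (sym (zσ j)) (∸-monoˡ-≤ 2 (minimal (σ ⟨$⟩ʳ j)))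

record Valley (f : ℕ → ℕ) (k m : ℕ) : Set where
  field
    bottom         : ℕ
    bottom+2≤k     : 2 + bottom ≤ k
    f[bottom]≡m    : f bottom ≡ m
    nonincreasing  : ∀ i → suc i < bottom → f (suc i) ≤ f i
    drop-to-bottom : ∀ i → suc i ≡ bottom → f (suc i) < f i
    nondecreasing  : ∀ i → bottom ≤ i → 2 + i ≤ k → f i ≤ f (suc i)

optimal-valley : ∀ {k} {d z : Fin k → ℕ} → MinOptimal d z → 3 ≤ k →
  (∀ (i j : Fin k) → toℕ i ≤ toℕ j → d j ≤ d i) → (k-1<k : k ∸ 1 < k) →
  Valley (extend z) k (d (fromℕ< k-1<k) ∸ 2)
optimal-valley {k} {d} {z} opt 3≤k d-antitone k-1<k
  with x , zx≡m ← IsPermOf-attains {d = d} (proj₁ opt) (fromℕ< k-1<k)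
  with t , t<k , ft≡m , first ←
         least-witness (λ y → extend z y ≟ d (fromℕ< k-1<k) ∸ 2) (toℕ<n x) (trans (sym (extend-toℕ z x)) zx≡m)
  = record
    { bottom         = t
    ; bottom+2≤k     = first-minimum-not-last {d = d} opt 3≤k t t<k below-first
    ; f[bottom]≡m    = ft≡m
    ; nonincreasing  = λ i 1+i<t →
                         nonincreasing-before-minimum f k (no-ascent-before-descent {d = d} opt) t<k minimum i (<⇒≤ 1+i<t)
    ; drop-to-bottom = λ { i refl → below-first i ≤-refl }
    ; nondecreasing  = nondecreasing-from-minimum f k (no-ascent-before-descent {d = d} opt) t<k minimum
    }
  where
  f : ℕ → ℕ
  f = extend z
  m : ℕ
  m = d (fromℕ< k-1<k) ∸ 2
  lower : ∀ y → y < k → m ≤ f y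
  lower y y<k =
    subst (m ≤_) (sym (extend-fromℕ< z y y<k)) (IsPermOf-lowerBound {d = d} (proj₁ opt) last-minimal (fromℕ< y<k))
    where
    last-minimal : ∀ i → d (fromℕ< k-1<k) ≤ d i
    last-minimal i = d-antitone i _ (subst (toℕ i ≤_) (sym (toℕ-fromℕ< k-1<k)) (<⇒≤pred (toℕ<n i)))
  minimum : ∀ y → y < k → f t ≤ f y
  minimum y y<k = subst (_≤ f y) (sym ft≡m) (lower y y<k)
  below-first : ∀ j → j < t → f t < f j
  below-first j j<t = subst (_< f j) (sym ft≡m) (≤∧≢⇒< (lower j (<-trans j<t t<k)) (λ m≡fj → first j j<t (sym m≡fj)))

theorem3p4 : (k : ℕ) → 3 ≤ k → (d : Fin k → ℕ)
    → (∀ i → 2 ≤ d i) → (∀ (i j : Fin k) → toℕ i ≤ toℕ j → d j ≤ d i)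
    → (z : Fin k → ℕ) → MinOptimal d z
    → (0<k : 0 < k) → (k-1<k : k ∸ 1 < k)
    → z (fromℕ< 0<k) ≥ z (fromℕ< k-1<k)
    → ∃ λ (t : Fin k) → toℕ t + 2 ≤ k ×
        z t ≡ d (fromℕ< k-1<k) ∸ 2 ×
        (∀ (i j : Fin k) → toℕ j ≡ suc (toℕ i) → toℕ j < toℕ t → z i ≥ z j) ×
        (∀ (i j : Fin k) → toℕ j ≡ suc (toℕ i) → toℕ j ≡ toℕ t → z i > z j) ×
        (∀ (i j : Fin k) → toℕ j ≡ suc (toℕ i) → toℕ t ≤ toℕ i → z i ≤ z j)
theorem3p4 k 3≤k d _ d-antitone z opt _ k-1<k _ =
  t , subst (_≤ k) (trans (+-comm 2 bottom) (cong (_+ 2) (sym t≡bottom))) bottom+2≤k ,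
  trans (z≡f t) (trans (cong f t≡bottom) f[bottom]≡m) ,
  (λ i j j≡ j<t → subst₂ _≤_ (sym (z≡f-next j≡)) (sym (z≡f i))
                    (nonincreasing (toℕ i) (subst₂ _<_ j≡ t≡bottom j<t))) ,
  (λ i j j≡ j≡t → subst₂ _<_ (sym (z≡f-next j≡)) (sym (z≡f i))
                    (drop-to-bottom (toℕ i) (trans (sym j≡) (trans j≡t t≡bottom)))) ,
  (λ i j j≡ t≤i → subst₂ _≤_ (sym (z≡f i)) (sym (z≡f-next j≡))
                    (nondecreasing (toℕ i) (subst (_≤ toℕ i) t≡bottom t≤i) (subst (_< k) j≡ (toℕ<n j))))
  where
  open Valley (optimal-valley opt 3≤k d-antitone k-1<k)
  f : ℕ → ℕ
  f = extend z
  t : Fin k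
  t = fromℕ< (<-trans (n<1+n bottom) bottom+2≤k)
  t≡bottom : toℕ t ≡ bottom
  t≡bottom = toℕ-fromℕ< _
  z≡f : ∀ i → z i ≡ f (toℕ i)
  z≡f = extend-toℕ z
  z≡f-next : ∀ {i j} → toℕ j ≡ suc (toℕ i) → z j ≡ f (suc (toℕ i))
  z≡f-next {j = j} j≡ = trans (z≡f j) (cong f j≡)
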